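{- Let $G$ be a finite simple graph with vertex set $V$ and $\bar G$ its complement. Then $\mathcal H_L(G)=\mathcal H_L(\bar G)$; if $G$ has no closed twins, $\mathcal H_I(G)=\mathcal H_O(\bar G)$; if $G$ has no open twins, $\mathcal H_O(G)=\mathcal H_I(\bar G)$; if $G$ has neither open nor closed twins, $\mathcal H_F(G)=\mathcal H_F(\bar G)$.
   Context: For a graph $G=(V,E)$, $N_G(v)$ denotes the open and $N_G[v]=N_G(v)\cup\{v\}$ the closed neighborhood of $v$; $A\triangle B=(A\setminus B)\cup(B\setminus A)$. Let $\triangle_a[G]$ (resp. $\triangle_a(G)$) be the set of all $N_G[u]\triangle N_G[v]$ (resp. $N_G(u)\triangle N_G(v)$) over pairs of distinct adjacent vertices $u,v$, and $\triangle_n[G]$ (resp. $\triangle_n(G)$) the analogous sets over pairs of distinct non-adjacent vertices. The separation hypergraphs on vertex set $V$ are $\mathcal H_L(G)=(V,\triangle_a(G)\cup\triangle_n[G])$, $\mathcal H_O(G)=(V,\triangle_a(G)\cup\triangle_n(G))$, $\mathcal H_I(G)=(V,\triangle_a[G]\cup\triangle_n[G])$, $\mathcal H_F(G)=(V,\triangle_a[G]\cup\triangle_n(G))$. Open twins are two non-adjacent vertices with equal open neighborhoods; closed twins are two adjacent vertices with equal closed neighborhoods. -}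

module Defs where

open import Data.Nat using (ℕ)
open import Data.Fin using (Fin; _≟_)
open import Data.Fin.Subset using (Subset; _─_; _∪_)
open import Data.Bool using (Bool; true; false; not; _∧_)
open import Data.Vec using (tabulate)
open import Data.Product using (_×_; ∃-syntax)
open import Data.Sum using (_⊎_)
open import Relation.Nullary using (¬_)
open import Relation.Nullary.Decidable using (⌊_⌋)
open import Relation.Binary.PropositionalEquality using (_≡_; refl; sym; cong₂)
open import Function.Bundles using (_⇔_)

record Graph (n : ℕ) : Set where
  field
    adj    : Fin n → Fin n → Bool
    symm   : ∀ u v → adj u v ≡ adj v u
    irrefl : ∀ u → adj u u ≡ false
open Graph public

complement : ∀ {n} → Graph n → Graph n
complement {n} G = record { adj = a ; symm = s ; irrefl = i }
  where
  a : Fin n → Fin n → Bool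
  a u v = not (adj G u v) ∧ not ⌊ u ≟ v ⌋
  eqs : ∀ (u v : Fin n) → ⌊ u ≟ v ⌋ ≡ ⌊ v ≟ u ⌋
  eqs u v with u ≟ v | v ≟ u
  ... | Relation.Nullary.yes _ | Relation.Nullary.yes _ = refl
  ... | Relation.Nullary.no _  | Relation.Nullary.no _  = refl
  ... | Relation.Nullary.yes p | Relation.Nullary.no q  = Data.Empty.⊥-elim (q (sym p))
    where import Data.Empty
  ... | Relation.Nullary.no q  | Relation.Nullary.yes p = Data.Empty.⊥-elim (q (sym p))
    where import Data.Empty
  s : ∀ u v → a u v ≡ a v u
  s u v = cong₂ (λ x y → not x ∧ not y) (symm G u v) (eqs u v)
  i : ∀ u → a u u ≡ false
  i u with u ≟ u
  ... | Relation.Nullary.yes _ = Data.Bool.Properties.∧-zeroʳ _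
    where import Data.Bool.Properties
  ... | Relation.Nullary.no ¬p = Data.Empty.⊥-elim (¬p refl)
    where import Data.Empty

N⟨_⟩ : ∀ {n} → Graph n → Fin n → Subset n
N⟨ G ⟩ u = tabulate (λ w → adj G u w)

N[_] : ∀ {n} → Graph n → Fin n → Subset n
N[ G ] u = tabulate (λ w → adj G u w Data.Bool.∨ ⌊ u ≟ w ⌋)
  where import Data.Bool

_△_ : ∀ {n} → Subset n → Subset n → Subset n
A △ B = (A ─ B) ∪ (B ─ A)

Hypergraph : ℕ → Set₁
Hypergraph n = Subset n → Set

_≅ᴴ_ : ∀ {n} → Hypergraph n → Hypergraph n → Set
H₁ ≅ᴴ H₂ = ∀ S → H₁ S ⇔ H₂ S

△a⟨_⟩ : ∀ {n} → Graph n → Hypergraph n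
△a⟨ G ⟩ S = ∃[ u ] ∃[ v ] (¬ u ≡ v × adj G u v ≡ true × S ≡ N⟨ G ⟩ u △ N⟨ G ⟩ v)

△a[_] : ∀ {n} → Graph n → Hypergraph n
△a[ G ] S = ∃[ u ] ∃[ v ] (¬ u ≡ v × adj G u v ≡ true × S ≡ N[ G ] u △ N[ G ] v)

△n⟨_⟩ : ∀ {n} → Graph n → Hypergraph n
△n⟨ G ⟩ S = ∃[ u ] ∃[ v ] (¬ u ≡ v × adj G u v ≡ false × S ≡ N⟨ G ⟩ u △ N⟨ G ⟩ v)

△n[_] : ∀ {n} → Graph n → Hypergraph n
△n[ G ] S = ∃[ u ] ∃[ v ] (¬ u ≡ v × adj G u v ≡ false × S ≡ N[ G ] u △ N[ G ] v)

ℋL ℋO ℋI ℋF : ∀ {n} → Graph n → Hypergraph n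
ℋL G S = △a⟨ G ⟩ S ⊎ △n[ G ] S
ℋO G S = △a⟨ G ⟩ S ⊎ △n⟨ G ⟩ S
ℋI G S = △a[ G ] S ⊎ △n[ G ] S
ℋF G S = △a[ G ] S ⊎ △n⟨ G ⟩ S

NoOpenTwins : ∀ {n} → Graph n → Set
NoOpenTwins G = ∀ u v → ¬ u ≡ v → adj G u v ≡ false → ¬ N⟨ G ⟩ u ≡ N⟨ G ⟩ v

NoClosedTwins : ∀ {n} → Graph n → Set
NoClosedTwins G = ∀ u v → ¬ u ≡ v → adj G u v ≡ true → ¬ N[ G ] u ≡ N[ G ] v

{-# OPTIONS --safe #-}
-- In the complement, N_Ḡ(u) = V ∖ N_G[u] and N_Ḡ[u] = V ∖ N_G(u), and
-- complementing both sets leaves a symmetric difference unchanged; so every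
-- open (closed) separating set of G is a closed (open) separating set of Ḡ,
-- for the same pair of vertices, while adjacency of distinct vertices flips.
-- Thus △a⟨G⟩ = △n[Ḡ], △n[G] = △a⟨Ḡ⟩, △a[G] = △n⟨Ḡ⟩ and △n⟨G⟩ = △a[Ḡ].
module Submission where

open import Defs
open import Data.Nat using (ℕ)
open import Data.Fin using (Fin; _≟_)
open import Data.Fin.Subset using (Subset; ∁)
open import Data.Bool using (Bool; true; false; not; _∧_; _∨_)
open import Data.Bool.Properties
  using (not-injective; ∧-identityʳ; ∨-identityʳ; ∨-zeroʳ; ∨-∧-booleanAlgebra)
open import Algebra.Lattice.Properties.BooleanAlgebra ∨-∧-booleanAlgebra using (deMorgan₂)
open import Data.Vec using (_∷_; []; tabulate)
open import Data.Vec.Properties using (tabulate-cong; tabulate-∘)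
open import Data.Product using (_×_; _,_; ∃-syntax)
open import Data.Sum using (_⊎_)
open import Data.Sum.Algebra using (⊎-comm)
open import Data.Sum.Function.Propositional using (_⊎-⇔_)
open import Function.Bundles using (_⇔_; mk⇔; Equivalence)
open import Function.Properties.Equivalence using () renaming (trans to ⇔-trans)
open import Function.Properties.Inverse using (↔⇒⇔)
open import Relation.Nullary using (¬_; yes; no)
open import Relation.Nullary.Decidable using (⌊_⌋; isYes≗does; dec-false)
open import Relation.Binary.PropositionalEquality
  using (_≡_; refl; sym; trans; cong; cong₂; module ≡-Reasoning)

∁-△-∁ : ∀ {n} (p q : Subset n) → ∁ p △ ∁ q ≡ p △ q
∁-△-∁ []          []          = refl
∁-△-∁ (false ∷ p) (false ∷ q) = cong (false ∷_) (∁-△-∁ p q)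
∁-△-∁ (false ∷ p) (true  ∷ q) = cong (true  ∷_) (∁-△-∁ p q)
∁-△-∁ (true  ∷ p) (false ∷ q) = cong (true  ∷_) (∁-△-∁ p q)
∁-△-∁ (true  ∷ p) (true  ∷ q) = cong (false ∷_) (∁-△-∁ p q)

-- △a⟨ G ⟩ is definitionally SymDiffs (adj G) true N⟨ G ⟩, and likewise
-- for the other three classes.
SymDiffs : ∀ {n} → (Fin n → Fin n → Bool) → Bool → (Fin n → Subset n) → Hypergraph n
SymDiffs E b N S = ∃[ u ] ∃[ v ] (¬ u ≡ v × E u v ≡ b × S ≡ N u △ N v)

SymDiffs-cong : ∀ {n} {E E' : Fin n → Fin n → Bool} {b b' : Bool}
                {N N' : Fin n → Subset n} →
                (∀ {u v} → ¬ u ≡ v → (E u v ≡ b) ⇔ (E' u v ≡ b')) →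
                (∀ u v → N u △ N v ≡ N' u △ N' v) →
                SymDiffs E b N ≅ᴴ SymDiffs E' b' N'
SymDiffs-cong E⇔E' N≡N' S = mk⇔
  (λ (u , v , u≢v , e , s) → u , v , u≢v , Equivalence.to (E⇔E' u≢v) e , trans s (N≡N' u v))
  (λ (u , v , u≢v , e , s) → u , v , u≢v , Equivalence.from (E⇔E' u≢v) e , trans s (sym (N≡N' u v)))

⊎-swap-≅ᴴ : ∀ {n} {H₁ H₂ K₁ K₂ : Hypergraph n} → H₁ ≅ᴴ K₂ → H₂ ≅ᴴ K₁ →
            (λ S → H₁ S ⊎ H₂ S) ≅ᴴ (λ S → K₁ S ⊎ K₂ S)
⊎-swap-≅ᴴ H₁≅K₂ H₂≅K₁ S = ⇔-trans (H₁≅K₂ S ⊎-⇔ H₂≅K₁ S) (↔⇒⇔ (⊎-comm _ _))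

module _ {n : ℕ} (G : Graph n) where

  private
    Ḡ : Graph n
    Ḡ = complement G

  complement-adj : ∀ {u v} → ¬ u ≡ v → adj Ḡ u v ≡ not (adj G u v)
  complement-adj {u} {v} u≢v =
    trans (cong (λ d → not (adj G u v) ∧ not d) (trans (isYes≗does (u ≟ v)) (dec-false (u ≟ v) u≢v))) (∧-identityʳ _)

  complement-adj⇔ : ∀ {u v b} → ¬ u ≡ v → (adj G u v ≡ b) ⇔ (adj Ḡ u v ≡ not b)
  complement-adj⇔ u≢v = mk⇔
    (λ e → trans (complement-adj u≢v) (cong not e))
    (λ e → not-injective (trans (sym (complement-adj u≢v)) e))

  N⟨complement⟩ : ∀ u → N⟨ Ḡ ⟩ u ≡ ∁ (N[ G ] u)
  N⟨complement⟩ u = begin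
    tabulate (λ w → not (adj G u w) ∧ not ⌊ u ≟ w ⌋)  ≡⟨ tabulate-cong (λ w → sym (deMorgan₂ (adj G u w) ⌊ u ≟ w ⌋)) ⟩
    tabulate (λ w → not (adj G u w ∨ ⌊ u ≟ w ⌋))      ≡⟨ tabulate-∘ not _ ⟩
    ∁ (N[ G ] u)                                       ∎
    where open ≡-Reasoning

  N[complement] : ∀ u → N[ Ḡ ] u ≡ ∁ (N⟨ G ⟩ u)
  N[complement] u = trans (tabulate-cong pointwise) (tabulate-∘ not _)
    where
    pointwise : ∀ w → (not (adj G u w) ∧ not ⌊ u ≟ w ⌋) ∨ ⌊ u ≟ w ⌋ ≡ not (adj G u w)
    pointwise w with u ≟ w
    ... | yes refl = trans (∨-zeroʳ _) (cong not (sym (irrefl G u)))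
    ... | no _     = trans (∨-identityʳ _) (∧-identityʳ _)

  △N⟨⟩-complement : ∀ u v → N⟨ G ⟩ u △ N⟨ G ⟩ v ≡ N[ Ḡ ] u △ N[ Ḡ ] v
  △N⟨⟩-complement u v = sym (begin
    N[ Ḡ ] u △ N[ Ḡ ] v          ≡⟨ cong₂ _△_ (N[complement] u) (N[complement] v) ⟩
    ∁ (N⟨ G ⟩ u) △ ∁ (N⟨ G ⟩ v)  ≡⟨ ∁-△-∁ _ _ ⟩
    N⟨ G ⟩ u △ N⟨ G ⟩ v          ∎)
    where open ≡-Reasoning

  △N[]-complement : ∀ u v → N[ G ] u △ N[ G ] v ≡ N⟨ Ḡ ⟩ u △ N⟨ Ḡ ⟩ v
  △N[]-complement u v = sym (begin
    N⟨ Ḡ ⟩ u △ N⟨ Ḡ ⟩ v          ≡⟨ cong₂ _△_ (N⟨complement⟩ u) (N⟨complement⟩ v) ⟩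
    ∁ (N[ G ] u) △ ∁ (N[ G ] v)  ≡⟨ ∁-△-∁ _ _ ⟩
    N[ G ] u △ N[ G ] v          ∎)
    where open ≡-Reasoning

  △a⟨⟩-complement : △a⟨ G ⟩ ≅ᴴ △n[ Ḡ ]
  △a⟨⟩-complement = SymDiffs-cong complement-adj⇔ △N⟨⟩-complement

  △n[]-complement : △n[ G ] ≅ᴴ △a⟨ Ḡ ⟩
  △n[]-complement = SymDiffs-cong complement-adj⇔ △N[]-complement

  △a[]-complement : △a[ G ] ≅ᴴ △n⟨ Ḡ ⟩
  △a[]-complement = SymDiffs-cong complement-adj⇔ △N[]-complement

  △n⟨⟩-complement : △n⟨ G ⟩ ≅ᴴ △a[ Ḡ ]
  △n⟨⟩-complement = SymDiffs-cong complement-adj⇔ △N⟨⟩-complement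

lemma5 : ∀ {n : ℕ} (G : Graph n) →
           (ℋL G ≅ᴴ ℋL (complement G))
         × (NoClosedTwins G → ℋI G ≅ᴴ ℋO (complement G))
         × (NoOpenTwins G → ℋO G ≅ᴴ ℋI (complement G))
         × (NoOpenTwins G → NoClosedTwins G → ℋF G ≅ᴴ ℋF (complement G))
lemma5 G =
    ⊎-swap-≅ᴴ (△a⟨⟩-complement G) (△n[]-complement G)
  , (λ _ → ⊎-swap-≅ᴴ (△a[]-complement G) (△n[]-complement G))
  , (λ _ → ⊎-swap-≅ᴴ (△a⟨⟩-complement G) (△n⟨⟩-complement G))
  , (λ _ _ → ⊎-swap-≅ᴴ (△a[]-complement G) (△n⟨⟩-complement G))
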